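{- For all integers $n \geq 3$ and $k \geq 1$ with $2k < n$, the \textbf{rna} number of the generalized Petersen graph $P(n,k)$ satisfies $$3 \leq \sigma^{ - }(P(n,k)) \leq n.$$
   Context: For $n \geq 3$, $k \geq 1$ with $2k<n$, the generalized Petersen graph $P(n,k)$ has vertex set $\{u_i, v_i : i=0,1,\dots,n-1\}$ and edge set $\{u_iu_{i+1},\ u_iv_i,\ v_iv_{i+k} : i=0,\dots,n-1\}$, subscripts read modulo $n$. For a simple connected graph $G$ of order $N$, the \textbf{rna} number $\sigma^{ - }(G)$ is the minimum, over all bijections $f: V(G)\to\{1,2,\dots,N\}$, of the number of edges $uv$ of $G$ such that $f(u)$ and $f(v)$ have different parity. Equivalently, it is the minimum number of edges between $A$ and $V(G)\setminus A$ over all $A\subseteq V(G)$ with $|A|=\lceil N/2\rceil$. -}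

module Defs where

open import Data.Nat using (ℕ; zero; suc; _+_; _*_; _%_; _<_; _≤_; NonZero)
open import Data.Nat.Properties using (_≟_)
open import Data.Fin using (Fin; toℕ; fromℕ<)
open import Data.Nat.DivMod using (m%n<n)
open import Data.Product using (_×_; _,_)
open import Data.Bool using (Bool; true; false)
open import Data.List using (List; []; _∷_; _++_; length; filter; concatMap; allFin)
open import Relation.Nullary using (¬_)
open import Relation.Nullary.Decidable using (¬?)
open import Function.Bundles using (_⤖_; Bijection)
open import Relation.Binary.PropositionalEquality using (_≡_)
open import Function using (_∘_)

PVertex : ℕ → Set
PVertex n = Bool × Fin n

u v : ∀ {n} → Fin n → PVertex n
u i = false , i
v i = true , i

_⊕_ : ∀ {n} .{{_ : NonZero n}} → Fin n → ℕ → Fin n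
_⊕_ {n} i j = fromℕ< (m%n<n (toℕ i + j) n)

-- For n ≥ 3 and 1 ≤ k < n/2 these 3n edges are pairwise distinct,
-- so this list is exactly the edge set of P(n,k).
PEdges : (n k : ℕ) .{{_ : NonZero n}} → List (PVertex n × PVertex n)
PEdges n k = concatMap (λ i → (u i , u (i ⊕ 1)) ∷ (u i , v i) ∷ (v i , v (i ⊕ k)) ∷ [])
                       (allFin n)

-- Labels are 1..N; label of x is toℕ (f x) + 1. Parity of label.
parity : ∀ {N} → Fin N → ℕ
parity a = (toℕ a + 1) % 2

diffParityEdges : ∀ {V : Set} {N : ℕ} → (V → Fin N) → List (V × V) → ℕ
diffParityEdges f es =
  length (filter (λ e → ¬? (parity (f (Data.Product.proj₁ e)) ≟ parity (f (Data.Product.proj₂ e)))) es)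

Labeling : (n : ℕ) → Set
Labeling n = PVertex n ⤖ Fin (2 * n)

rnaCount : (n k : ℕ) .{{_ : NonZero n}} → Labeling n → ℕ
rnaCount n k f = diffParityEdges (Bijection.to f) (PEdges n k)

IsRnaNumber : (n k : ℕ) .{{_ : NonZero n}} → ℕ → Set
IsRnaNumber n k m =
  Data.Product.Σ (Labeling n) (λ f → rnaCount n k f ≡ m)
  × (∀ (f : Labeling n) → m ≤ rnaCount n k f)

-- A labelling splits the vertices into the two parity classes, each of size n, and counts the
-- edges between them.  Labelling u_i by 2i and v_i by 2i + 1 cuts exactly the n spokes.
-- For the lower bound, a cut outer edge forces a second one, because going round the outer cycle returns
-- to the starting parity; then either a spoke or inner edge is cut as well, or the parity of u_i
-- is k-periodic and the outer edges at p, p + k and p + 2k (distinct as 2k < n) are all cut.  If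
-- no outer edge is cut, all u_i share one parity, so every label of the other parity sits on
-- some v_i and its spoke is cut; there are at least three such labels.  The minimum exists since
-- labellings embed into the finite type of vectors Vec (Fin 2n) 2n.
module Submission where

open import Defs
open import Data.Nat using (ℕ; zero; suc; pred; _+_; _*_; _∸_; _%_; _/_; _≤_; _<_; _≤?_; z≤n; s≤s;
                            NonZero; >-nonZero⁻¹)
open import Data.Nat.Properties
open import Data.Nat.DivMod
open import Data.Bool using (Bool; true; false)
open import Data.Fin using (Fin; zero; suc; toℕ; fromℕ<; inject≤; cast; #_)
import Data.Fin.Properties as Fin
open import Data.Product using (Σ; ∃; _×_; _,_; proj₁; proj₂)
open import Data.Product.Algebra using (×-comm)
open import Data.Product.Function.NonDependent.Propositional using (_×-↔_)
open import Data.List using (List; []; _∷_; _++_; length; filter; concatMap; tabulate)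
import Data.List.Properties as List
open import Data.List.Relation.Unary.All as All using (All; []; _∷_)
open import Data.List.Relation.Unary.Unique.Propositional using (Unique; []; _∷_)
open import Data.Vec as Vec using (Vec; []; _∷_; lookup)
open import Data.Vec.Properties using (lookup∘tabulate)
open import Algebra.Properties.CommutativeMonoid.Sum +-0-commutativeMonoid
  using (sum-syntax; ∑-distrib-+; sum-cong-≗; sum-replicate-zero)
open import Function using (id; _∘_)
open import Function.Bundles using (_↔_; Inverse; mk↔ₛ′; Bijection; mk⤖)
open import Function.Definitions using (Bijective)
open import Function.Consequences.Propositional using (strictlySurjective⇒surjective)
open import Function.Construct.Composition using (_⤖-∘_)
open import Function.Properties.Inverse using (↔-refl; ↔-sym; ↔-trans; ↔⇒⤖)
open import Relation.Nullary using (Dec; yes; no; contradiction)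
open import Relation.Nullary.Decidable using (¬?; map′; _×-dec_; _→-dec_; decidable-stable)
open import Relation.Binary using (DecidableEquality)
open import Relation.Binary.PropositionalEquality

∑-mono-≤ : ∀ {n} {f g : Fin n → ℕ} → (∀ i → f i ≤ g i) → ∑[ i < n ] f i ≤ ∑[ i < n ] g i
∑-mono-≤ {zero}  f≤g = z≤n
∑-mono-≤ {suc n} f≤g = +-mono-≤ (f≤g zero) (∑-mono-≤ (f≤g ∘ suc))

∑-const-1 : ∀ n → ∑[ i < n ] 1 ≡ n
∑-const-1 zero    = refl
∑-const-1 (suc n) = cong suc (∑-const-1 n)

δ : ∀ {n} → Fin n → Fin n → ℕ
δ zero    zero    = 1
δ zero    (suc _) = 0
δ (suc _) zero    = 0
δ (suc p) (suc j) = δ p j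

δ-≢ : ∀ {n} {p j : Fin n} → p ≢ j → δ p j ≡ 0
δ-≢ {p = zero}  {zero}  p≢j = contradiction refl p≢j
δ-≢ {p = zero}  {suc j} p≢j = refl
δ-≢ {p = suc p} {zero}  p≢j = refl
δ-≢ {p = suc p} {suc j} p≢j = δ-≢ (p≢j ∘ cong suc)

δ≤ : ∀ {n} {w : Fin n → ℕ} {p : Fin n} → 1 ≤ w p → ∀ j → δ p j ≤ w j
δ≤         {p = zero}  wp zero    = wp
δ≤         {p = zero}  wp (suc j) = z≤n
δ≤         {p = suc p} wp zero    = z≤n
δ≤ {w = w} {p = suc p} wp (suc j) = δ≤ {w = w ∘ suc} wp j

∑-δ : ∀ {n} (p : Fin n) → ∑[ j < n ] δ p j ≡ 1
∑-δ {suc n} zero    = cong suc (sum-replicate-zero n)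
∑-δ {suc n} (suc p) = ∑-δ p

∑-peel : ∀ {n} (w : Fin n → ℕ) {p : Fin n} → 1 ≤ w p → ∑[ j < n ] w j ≡ suc (∑[ j < n ] (w j ∸ δ p j))
∑-peel {n} w {p} wp = begin
  ∑[ j < n ] w j                              ≡⟨ sum-cong-≗ (λ j → sym (m+[n∸m]≡n (δ≤ {w = w} wp j))) ⟩
  ∑[ j < n ] (δ p j + (w j ∸ δ p j))          ≡⟨ ∑-distrib-+ (δ p) _ ⟩
  ∑[ j < n ] δ p j + ∑[ j < n ] (w j ∸ δ p j) ≡⟨ cong (_+ ∑[ j < n ] (w j ∸ δ p j)) (∑-δ p) ⟩
  suc (∑[ j < n ] (w j ∸ δ p j))              ∎
  where open ≡-Reasoning

length≤∑ : ∀ {n} (w : Fin n → ℕ) {ps : List (Fin n)} →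
           Unique ps → All (λ p → 1 ≤ w p) ps → length ps ≤ ∑[ j < n ] w j
length≤∑ w []                            []          = z≤n
length≤∑ w {p ∷ ps} (p∉ps ∷ ps-unique) (wp ∷ wps) =
  subst (suc (length ps) ≤_) (sym (∑-peel w wp))
    (s≤s (length≤∑ (λ j → w j ∸ δ p j) ps-unique (All.zipWith still-positive (p∉ps , wps))))
  where
  still-positive : ∀ {q} → p ≢ q × 1 ≤ w q → 1 ≤ w q ∸ δ p q
  still-positive (p≢q , wq) = subst (λ d → 1 ≤ _ ∸ d) (sym (δ-≢ p≢q)) wq

module Cyclic {n : ℕ} .{{_ : NonZero n}} where

  toℕ-⊕ : ∀ (i : Fin n) j → toℕ (i ⊕ j) ≡ (toℕ i + j) % n
  toℕ-⊕ i j = Fin.toℕ-fromℕ< _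

  ⊕-assoc : ∀ (i : Fin n) a b → (i ⊕ a) ⊕ b ≡ i ⊕ (a + b)
  ⊕-assoc i a b = Fin.toℕ-injective (begin
    toℕ ((i ⊕ a) ⊕ b)                 ≡⟨ toℕ-⊕ (i ⊕ a) b ⟩
    (toℕ (i ⊕ a) + b) % n             ≡⟨ cong (λ x → (x + b) % n) (toℕ-⊕ i a) ⟩
    ((toℕ i + a) % n + b) % n         ≡⟨ %-distribˡ-+ ((toℕ i + a) % n) b n ⟩
    ((toℕ i + a) % n % n + b % n) % n ≡⟨ cong (λ x → (x + b % n) % n) (m%n%n≡m%n (toℕ i + a) n) ⟩
    ((toℕ i + a) % n + b % n) % n     ≡⟨ %-distribˡ-+ (toℕ i + a) b n ⟨
    (toℕ i + a + b) % n               ≡⟨ cong (_% n) (+-assoc (toℕ i) a b) ⟩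
    (toℕ i + (a + b)) % n             ≡⟨ toℕ-⊕ i (a + b) ⟨
    toℕ (i ⊕ (a + b))                 ∎)
    where open ≡-Reasoning

  ⊕-suc : ∀ (i : Fin n) t → (i ⊕ t) ⊕ 1 ≡ i ⊕ suc t
  ⊕-suc i t = trans (⊕-assoc i t 1) (cong (i ⊕_) (+-comm t 1))

  ⊕-comm : ∀ (i : Fin n) a b → (i ⊕ a) ⊕ b ≡ (i ⊕ b) ⊕ a
  ⊕-comm i a b = trans (⊕-assoc i a b) (trans (cong (i ⊕_) (+-comm a b)) (sym (⊕-assoc i b a)))

  ⊕-identityʳ : ∀ (i : Fin n) → i ⊕ 0 ≡ i
  ⊕-identityʳ i = Fin.toℕ-injective
    (trans (toℕ-⊕ i 0) (trans (cong (_% n) (+-identityʳ (toℕ i))) (m<n⇒m%n≡m (Fin.toℕ<n i))))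

  ⊕-full-turn : ∀ (i : Fin n) → i ⊕ n ≡ i
  ⊕-full-turn i = Fin.toℕ-injective
    (trans (toℕ-⊕ i n) (trans ([m+n]%n≡m%n (toℕ i) n) (m<n⇒m%n≡m (Fin.toℕ<n i))))

  -- i + j ≡ i (mod n) makes j a multiple of n.
  ⊕-≢ : ∀ (i : Fin n) {j} → 0 < j → j < n → i ⊕ j ≢ i
  ⊕-≢ i {j} 0<j j<n i⊕j≡i = excluded ((toℕ i + j) / n) j≡q*n
    where
    j≡q*n : j ≡ (toℕ i + j) / n * n
    j≡q*n = +-cancelˡ-≡ (toℕ i) j _ (trans (m≡m%n+[m/n]*n (toℕ i + j) n)
      (cong (_+ (toℕ i + j) / n * n) (trans (sym (toℕ-⊕ i j)) (cong toℕ i⊕j≡i))))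
    excluded : ∀ q → j ≢ q * n
    excluded zero    j≡0   = <⇒≢ 0<j (sym j≡0)
    excluded (suc q) j≡q*n = <⇒≱ j<n (subst (n ≤_) (sym j≡q*n) (m≤m+n n (q * n)))

  steps⇒≡ : ∀ {A : Set} (h : Fin n → A) (i : Fin n) j →
            (∀ t → t < j → h (i ⊕ t) ≡ h ((i ⊕ t) ⊕ 1)) → h i ≡ h (i ⊕ j)
  steps⇒≡ h i zero    steps = cong h (sym (⊕-identityʳ i))
  steps⇒≡ h i (suc j) steps = trans (steps⇒≡ h i j (λ t t<j → steps t (m<n⇒m<1+n t<j)))
                                    (trans (steps j (n<1+n j)) (cong h (⊕-suc i j)))

  ⊕-reaches : ∀ (i j : Fin n) → i ⊕ (n ∸ toℕ i + toℕ j) ≡ j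
  ⊕-reaches i j = Fin.toℕ-injective (begin
    toℕ (i ⊕ (n ∸ toℕ i + toℕ j))      ≡⟨ toℕ-⊕ i _ ⟩
    (toℕ i + (n ∸ toℕ i + toℕ j)) % n  ≡⟨ cong (_% n) (+-assoc (toℕ i) _ (toℕ j)) ⟨
    (toℕ i + (n ∸ toℕ i) + toℕ j) % n  ≡⟨ cong (λ x → (x + toℕ j) % n) (m+[n∸m]≡n (<⇒≤ (Fin.toℕ<n i))) ⟩
    (n + toℕ j) % n                    ≡⟨ cong (_% n) (+-comm n (toℕ j)) ⟩
    (toℕ j + n) % n                    ≡⟨ [m+n]%n≡m%n (toℕ j) n ⟩
    toℕ j % n                          ≡⟨ m<n⇒m%n≡m (Fin.toℕ<n j) ⟩
    toℕ j                              ∎)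
    where open ≡-Reasoning

  steps⇒constant : ∀ {A : Set} (h : Fin n → A) → (∀ i → h i ≡ h (i ⊕ 1)) → ∀ i j → h i ≡ h j
  steps⇒constant h step i j = trans (steps⇒≡ h i _ (λ t _ → step (i ⊕ t))) (cong h (⊕-reaches i j))

  -- Going once around the cycle returns to the start, so a value cannot change at one step only.
  second-change : ∀ {A : Set} → DecidableEquality A → (h : Fin n → A) {p : Fin n} →
                  h p ≢ h (p ⊕ 1) → ∃ λ q → q ≢ p × h q ≢ h (q ⊕ 1)
  second-change _≟_ h {p} change
    with Fin.any? (λ q → ¬? (q Fin.≟ p) ×-dec ¬? (h q ≟ h (q ⊕ 1)))
  ... | yes found = found
  ... | no none   = contradiction (sym around) change
    where
    step : ∀ q → q ≢ p → h q ≡ h (q ⊕ 1)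
    step q q≢p = decidable-stable (h q ≟ h (q ⊕ 1)) (λ q-changes → none (q , q≢p , q-changes))
    misses-p : ∀ t → t < pred n → (p ⊕ 1) ⊕ t ≢ p
    misses-p t t<n-1 eq =
      ⊕-≢ p (s≤s z≤n) (subst (suc t <_) (suc-pred n) (s≤s t<n-1)) (trans (sym (⊕-assoc p 1 t)) eq)
    back-at-p : (p ⊕ 1) ⊕ pred n ≡ p
    back-at-p = trans (⊕-assoc p 1 (pred n)) (trans (cong (p ⊕_) (suc-pred n)) (⊕-full-turn p))
    around : h (p ⊕ 1) ≡ h p
    around = trans (steps⇒≡ h (p ⊕ 1) (pred n) (λ t t<n-1 → step _ (misses-p t t<n-1))) (cong h back-at-p)

module Counting {V : Set} {N : ℕ} (F : V → Fin N) where

  differ? : (e : V × V) → Dec (parity (F (proj₁ e)) ≢ parity (F (proj₂ e)))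
  differ? e = ¬? (parity (F (proj₁ e)) ≟ parity (F (proj₂ e)))

  cut : V × V → ℕ
  cut e = diffParityEdges F (e ∷ [])

  cut-≢ : ∀ {x y} → parity (F x) ≢ parity (F y) → cut (x , y) ≡ 1
  cut-≢ ne = cong length (List.filter-accept differ? {xs = []} ne)

  cut-≡ : ∀ {x y} → parity (F x) ≡ parity (F y) → cut (x , y) ≡ 0
  cut-≡ eq = cong length (List.filter-reject differ? {xs = []} (λ ne → ne eq))

  cut-positive : ∀ {x y} → parity (F x) ≢ parity (F y) → 1 ≤ cut (x , y)
  cut-positive ne = ≤-reflexive (sym (cut-≢ ne))

  cut≡0⇒≡ : ∀ {x y} → cut (x , y) ≡ 0 → parity (F x) ≡ parity (F y)
  cut≡0⇒≡ {x} {y} cut≡0 with parity (F x) ≟ parity (F y)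
  ... | yes eq = eq
  ... | no  ne = contradiction (trans (sym cut≡0) (cut-≢ ne)) λ ()

  diffParityEdges-++ : ∀ es fs → diffParityEdges F (es ++ fs) ≡ diffParityEdges F es + diffParityEdges F fs
  diffParityEdges-++ es fs =
    trans (cong length (List.filter-++ _ es fs)) (List.length-++ (filter _ es))

  diffParityEdges-∷ : ∀ e es → diffParityEdges F (e ∷ es) ≡ cut e + diffParityEdges F es
  diffParityEdges-∷ e = diffParityEdges-++ (e ∷ [])

  diffParityEdges-concatMap : ∀ {A : Set} {m} (g : A → List (V × V)) (f : Fin m → A) →
    diffParityEdges F (concatMap g (tabulate f)) ≡ ∑[ i < m ] diffParityEdges F (g (f i))
  diffParityEdges-concatMap {m = zero}  g f = refl
  diffParityEdges-concatMap {m = suc m} g f =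
    trans (diffParityEdges-++ (g (f zero)) _) (cong (_ +_) (diffParityEdges-concatMap g (f ∘ suc)))

diffParityEdges-cong : ∀ {V : Set} {N} {F G : V → Fin N} → (∀ x → F x ≡ G x) →
                       ∀ es → diffParityEdges F es ≡ diffParityEdges G es
diffParityEdges-cong {V} {N} {F} {G} F≗G es =
  cong length (List.filter-≐ (Counting.differ? F) (Counting.differ? G) (transport F≗G , transport (sym ∘ F≗G)) es)
  where
  transport : ∀ {F G : V → Fin N} → (∀ x → F x ≡ G x) → ∀ {e} →
              parity (F (proj₁ e)) ≢ parity (F (proj₂ e)) → parity (G (proj₁ e)) ≢ parity (G (proj₂ e))
  transport F≗G {x , y} ne eq = ne (subst₂ (λ a b → parity a ≡ parity b) (sym (F≗G x)) (sym (F≗G y)) eq)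

module EdgeCounts (n k : ℕ) .{{_ : NonZero n}} (F : PVertex n → Fin (2 * n)) where
  open Counting F
  open Cyclic {n}

  outer spoke inner : Fin n → ℕ
  outer i = cut (u i , u (i ⊕ 1))
  spoke i = cut (u i , v i)
  inner i = cut (v i , v (i ⊕ k))

  count-split : diffParityEdges F (PEdges n k) ≡ ∑[ i < n ] outer i + ∑[ i < n ] (spoke i + inner i)
  count-split = begin
    diffParityEdges F (PEdges n k)                      ≡⟨ diffParityEdges-concatMap edges id ⟩
    ∑[ i < n ] diffParityEdges F (edges i)              ≡⟨ sum-cong-≗ three-edges ⟩
    ∑[ i < n ] (outer i + (spoke i + inner i))          ≡⟨ ∑-distrib-+ outer _ ⟩
    ∑[ i < n ] outer i + ∑[ i < n ] (spoke i + inner i) ∎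
    where
    open ≡-Reasoning
    edges : Fin n → List (PVertex n × PVertex n)
    edges i = (u i , u (i ⊕ 1)) ∷ (u i , v i) ∷ (v i , v (i ⊕ k)) ∷ []
    three-edges : ∀ i → diffParityEdges F (edges i) ≡ outer i + (spoke i + inner i)
    three-edges i = trans (diffParityEdges-∷ _ _) (cong (outer i +_) (diffParityEdges-∷ _ _))

  uParity : Fin n → ℕ
  uParity i = parity (F (u i))

  count : ℕ
  count = diffParityEdges F (PEdges n k)

  ∑outer≤count : ∑[ i < n ] outer i ≤ count
  ∑outer≤count = ≤-trans (m≤m+n _ _) (≤-reflexive (sym count-split))

  ∑spoke≤count : ∑[ i < n ] spoke i ≤ count
  ∑spoke≤count = begin
    ∑[ i < n ] spoke i                                  ≤⟨ ∑-mono-≤ (λ i → m≤m+n (spoke i) (inner i)) ⟩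
    ∑[ i < n ] (spoke i + inner i)                      ≤⟨ m≤n+m _ _ ⟩
    ∑[ i < n ] outer i + ∑[ i < n ] (spoke i + inner i) ≡⟨ count-split ⟨
    count                                               ∎
    where open ≤-Reasoning

  k-periodic-of-uncut : (∀ i → spoke i + inner i ≡ 0) → ∀ i → uParity i ≡ uParity (i ⊕ k)
  k-periodic-of-uncut uncut i = trans (spoke-uncut i) (trans inner-uncut (sym (spoke-uncut (i ⊕ k))))
    where
    spoke-uncut : ∀ j → uParity j ≡ parity (F (v j))
    spoke-uncut j = cut≡0⇒≡ (m+n≡0⇒m≡0 (spoke j) (uncut j))
    inner-uncut : parity (F (v i)) ≡ parity (F (v (i ⊕ k)))
    inner-uncut = cut≡0⇒≡ (m+n≡0⇒n≡0 (spoke i) (uncut i))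

  three≤count-of-k-periodic : 1 ≤ k → 2 * k < n → (∀ i → uParity i ≡ uParity (i ⊕ k)) →
                              ∀ {p} → uParity p ≢ uParity (p ⊕ 1) → 3 ≤ count
  three≤count-of-k-periodic 1≤k 2k<n k-periodic {p} change = ≤-trans three-outer ∑outer≤count
    where
    shift : ∀ {j} → uParity j ≢ uParity (j ⊕ 1) → uParity (j ⊕ k) ≢ uParity ((j ⊕ k) ⊕ 1)
    shift {j} change eq = change (begin
      uParity j              ≡⟨ k-periodic j ⟩
      uParity (j ⊕ k)        ≡⟨ eq ⟩
      uParity ((j ⊕ k) ⊕ 1)  ≡⟨ cong uParity (⊕-comm j k 1) ⟩
      uParity ((j ⊕ 1) ⊕ k)  ≡⟨ k-periodic (j ⊕ 1) ⟨
      uParity (j ⊕ 1)        ∎)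
      where open ≡-Reasoning
    k+k<n : k + k < n
    k+k<n = subst (_< n) (cong (k +_) (+-identityʳ k)) 2k<n
    k<n : k < n
    k<n = ≤-<-trans (m≤m+n k k) k+k<n
    p₁ p₂ : Fin n
    p₁ = p ⊕ k
    p₂ = p₁ ⊕ k
    p≢p₁ : p ≢ p₁
    p≢p₁ = ⊕-≢ p 1≤k k<n ∘ sym
    p₁≢p₂ : p₁ ≢ p₂
    p₁≢p₂ = ⊕-≢ p₁ 1≤k k<n ∘ sym
    p≢p₂ : p ≢ p₂
    p≢p₂ eq = ⊕-≢ p (≤-trans 1≤k (m≤m+n k k)) k+k<n (trans (sym (⊕-assoc p k k)) (sym eq))
    three-outer : 3 ≤ ∑[ i < n ] outer i
    three-outer = length≤∑ outer ((p≢p₁ ∷ p≢p₂ ∷ []) ∷ (p₁≢p₂ ∷ []) ∷ [] ∷ [])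
      (cut-positive change ∷ cut-positive (shift change) ∷ cut-positive (shift (shift change)) ∷ [])

  three≤count-of-outer-change : 1 ≤ k → 2 * k < n → ∀ {p} → uParity p ≢ uParity (p ⊕ 1) → 3 ≤ count
  three≤count-of-outer-change 1≤k 2k<n {p} change with Fin.any? (λ i → 1 ≤? spoke i + inner i)
  ... | yes (i , i-cut) with q , q≢p , q-change ← second-change _≟_ uParity change =
    subst (3 ≤_) (sym count-split) (+-mono-≤ two-outer one-other)
    where
    two-outer : 2 ≤ ∑[ i < n ] outer i
    two-outer = length≤∑ outer ((q≢p ∘ sym ∷ []) ∷ [] ∷ []) (cut-positive change ∷ cut-positive q-change ∷ [])
    one-other : 1 ≤ ∑[ i < n ] (spoke i + inner i)
    one-other = length≤∑ (λ i → spoke i + inner i) ([] ∷ []) (i-cut ∷ [])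
  ... | no none = three≤count-of-k-periodic 1≤k 2k<n (k-periodic-of-uncut uncut) change
    where
    uncut : ∀ i → spoke i + inner i ≡ 0
    uncut i = n<1⇒n≡0 (≰⇒> λ i-cut → none (i , i-cut))

  three≤count-of-constant : 3 ≤ n → (∀ a → ∃ λ x → F x ≡ a) → ∀ c → (∀ i → uParity i ≡ c) → 3 ≤ count
  three≤count-of-constant 3≤n onto c uParity≡c = pick-labels (c ≟ 1)
    where
    6≤2n : 6 ≤ 2 * n
    6≤2n = *-monoʳ-≤ 2 3≤n
    label : Fin 6 → Fin (2 * n)
    label j = inject≤ j 6≤2n
    avoids : ∀ j → (toℕ j + 1) % 2 ≢ c → parity (label j) ≢ c
    avoids j ne eq = ne (trans (cong (λ t → (t + 1) % 2) (sym (Fin.toℕ-inject≤ j 6≤2n))) eq)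
    on-spoke : ∀ a → parity a ≢ c → ∃ λ i → F (v i) ≡ a
    on-spoke a a≢c with onto a
    ... | (false , i) , Fu≡a = contradiction (trans (cong parity (sym Fu≡a)) (uParity≡c i)) a≢c
    ... | (true  , i) , Fv≡a = i , Fv≡a
    spoke-cut : ∀ {i a} → F (v i) ≡ a → parity a ≢ c → 1 ≤ spoke i
    spoke-cut {i} refl a≢c = cut-positive λ eq → a≢c (trans (sym eq) (uParity≡c i))
    distinct : ∀ {i i' j j'} → F (v i) ≡ label j → F (v i') ≡ label j' → j ≢ j' → i ≢ i'
    distinct e e' j≢j' refl = j≢j' (Fin.inject≤-injective _ _ _ _ (trans (sym e) e'))
    three-spokes : ∀ (j₁ j₂ j₃ : Fin 6) → j₁ ≢ j₂ → j₁ ≢ j₃ → j₂ ≢ j₃ →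
                   parity (label j₁) ≢ c → parity (label j₂) ≢ c → parity (label j₃) ≢ c → 3 ≤ count
    three-spokes j₁ j₂ j₃ j₁≢j₂ j₁≢j₃ j₂≢j₃ c₁ c₂ c₃
      with (i₁ , e₁) ← on-spoke (label j₁) c₁ | (i₂ , e₂) ← on-spoke (label j₂) c₂
         | (i₃ , e₃) ← on-spoke (label j₃) c₃ =
      ≤-trans three ∑spoke≤count
      where
      three : 3 ≤ ∑[ i < n ] spoke i
      three = length≤∑ spoke ((distinct e₁ e₂ j₁≢j₂ ∷ distinct e₁ e₃ j₁≢j₃ ∷ []) ∷ (distinct e₂ e₃ j₂≢j₃ ∷ []) ∷ [] ∷ [])
                              (spoke-cut e₁ c₁ ∷ spoke-cut e₂ c₂ ∷ spoke-cut e₃ c₃ ∷ [])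
    pick-labels : Dec (c ≡ 1) → 3 ≤ count
    pick-labels (yes c≡1) = three-spokes (# 1) (# 3) (# 5) (λ ()) (λ ()) (λ ())
      (avoids (# 1) 0≢c) (avoids (# 3) 0≢c) (avoids (# 5) 0≢c)
      where
      0≢c : 0 ≢ c
      0≢c eq = 0≢1+n (trans eq c≡1)
    pick-labels (no c≢1) = three-spokes (# 0) (# 2) (# 4) (λ ()) (λ ()) (λ ())
      (avoids (# 0) (c≢1 ∘ sym)) (avoids (# 2) (c≢1 ∘ sym)) (avoids (# 4) (c≢1 ∘ sym))

  three≤count : 3 ≤ n → 1 ≤ k → 2 * k < n → (∀ a → ∃ λ x → F x ≡ a) → 3 ≤ count
  three≤count 3≤n 1≤k 2k<n onto with Fin.any? (λ i → ¬? (uParity i ≟ uParity (i ⊕ 1)))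
  ... | yes (p , change) = three≤count-of-outer-change 1≤k 2k<n change
  ... | no  none         = three≤count-of-constant 3≤n onto (uParity origin)
                             (λ i → steps⇒constant uParity step i origin)
    where
    origin : Fin n
    origin = fromℕ< (>-nonZero⁻¹ n)
    step : ∀ i → uParity i ≡ uParity (i ⊕ 1)
    step i = decidable-stable (uParity i ≟ uParity (i ⊕ 1)) (λ change → none (i , change))

AttainsMinima : Set → Set
AttainsMinima A = (w : A → ℕ) → ∃ λ a → ∀ b → w a ≤ w b

Fin-attainsMinima : ∀ {m} .{{_ : NonZero m}} → AttainsMinima (Fin m)
Fin-attainsMinima {zero} {{()}}
Fin-attainsMinima {suc zero}    w = zero , λ { zero → ≤-refl }
Fin-attainsMinima {suc (suc m)} w with Fin-attainsMinima (w ∘ suc)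
... | i , min with w zero ≤? w (suc i)
...   | yes w0≤ = zero  , λ { zero → ≤-refl ; (suc j) → ≤-trans w0≤ (min j) }
...   | no  w0≰ = suc i , λ { zero → <⇒≤ (≰⇒> w0≰) ; (suc j) → min j }

-- Minimise the head with the tail chosen optimally for each head.
Vec-attainsMinima : ∀ {A : Set} → AttainsMinima A → ∀ N → AttainsMinima (Vec A N)
Vec-attainsMinima min-A zero    w = [] , λ { [] → ≤-refl }
Vec-attainsMinima {A} min-A (suc N) w =
  x ∷ best-tail x , λ { (y ∷ ys) → ≤-trans (x-min y) (tail-min y ys) }
  where
  best-tail : A → Vec A N
  best-tail y = proj₁ (Vec-attainsMinima min-A N (w ∘ (y ∷_)))
  tail-min : ∀ y ys → w (y ∷ best-tail y) ≤ w (y ∷ ys)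
  tail-min y = proj₂ (Vec-attainsMinima min-A N (w ∘ (y ∷_)))
  x : A
  x = proj₁ (min-A (λ y → w (y ∷ best-tail y)))
  x-min : ∀ y → w (x ∷ best-tail x) ≤ w (y ∷ best-tail y)
  x-min = proj₂ (min-A (λ y → w (y ∷ best-tail y)))

attainsMinimum-via-section : ∀ {A B : Set} (w : B → ℕ) (decode : A → B) (encode : B → A) →
  (∀ b → w (decode (encode b)) ≡ w b) → AttainsMinima A → ∃ λ b → ∀ b′ → w b ≤ w b′
attainsMinimum-via-section w decode encode w-section min-A with a , a-min ← min-A (w ∘ decode) =
  decode a , λ b → ≤-trans (a-min (encode b)) (≤-reflexive (w-section b))

bijective? : ∀ {N} (g : Fin N → Fin N) → Dec (Bijective _≡_ _≡_ g)
bijective? g = injective? ×-dec surjective?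
  where
  injective? : Dec (∀ {x y} → g x ≡ g y → x ≡ y)
  injective? = map′ (λ inj {x} {y} → inj x y) (λ inj x y → inj)
                    (Fin.all? λ x → Fin.all? λ y → (g x Fin.≟ g y) →-dec (x Fin.≟ y))
  surjective? : Dec (∀ y → ∃ λ x → ∀ {z} → z ≡ x → g z ≡ y)
  surjective? = map′ (λ s y → proj₁ (s y) , λ { refl → proj₂ (s y) }) (λ s y → proj₁ (s y) , proj₂ (s y) refl)
                     (Fin.all? λ y → Fin.any? λ x → g x Fin.≟ y)

-- Sends u_i to 2i and v_i to 2i + 1.
interleaving : ∀ {n} → PVertex n ↔ Fin (2 * n)
interleaving {n} =
  ↔-trans (×-comm Bool (Fin n)) (↔-trans (↔-refl ×-↔ ↔-sym Fin.2↔Bool) (↔-trans (↔-sym Fin.*↔×) cast↔))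
  where
  cast↔ : Fin (n * 2) ↔ Fin (2 * n)
  cast↔ = mk↔ₛ′ (cast (*-comm n 2)) (cast (*-comm 2 n))
                (Fin.cast-involutive (*-comm n 2) (*-comm 2 n)) (Fin.cast-involutive (*-comm 2 n) (*-comm n 2))

parity-interleaving : ∀ {n} b (i : Fin n) →
  parity (Inverse.to interleaving (b , i)) ≡ (toℕ (Inverse.from Fin.2↔Bool b) + 1) % 2
parity-interleaving b i = begin
  (toℕ (Inverse.to interleaving (b , i)) + 1) % 2  ≡⟨ cong (λ t → (t + 1) % 2) (trans (Fin.toℕ-cast _ _) (Fin.toℕ-combine i j)) ⟩
  (2 * toℕ i + toℕ j + 1) % 2                     ≡⟨ cong (_% 2) (+-assoc (2 * toℕ i) (toℕ j) 1) ⟩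
  (2 * toℕ i + (toℕ j + 1)) % 2                   ≡⟨ cong (_% 2) (+-comm (2 * toℕ i) (toℕ j + 1)) ⟩
  (toℕ j + 1 + 2 * toℕ i) % 2                     ≡⟨ cong (λ t → (toℕ j + 1 + t) % 2) (*-comm 2 (toℕ i)) ⟩
  (toℕ j + 1 + toℕ i * 2) % 2                     ≡⟨ [m+kn]%n≡m%n (toℕ j + 1) (toℕ i) 2 ⟩
  (toℕ j + 1) % 2                                 ∎
  where
  open ≡-Reasoning
  j : Fin 2
  j = Inverse.from Fin.2↔Bool b

reference : ∀ {n} → Labeling n
reference = ↔⇒⤖ interleaving

rnaCount-reference : ∀ n k .{{_ : NonZero n}} → rnaCount n k reference ≡ n
rnaCount-reference n k = trans count-split
  (cong₂ _+_ (trans (sum-cong-≗ outer≡0) (sum-replicate-zero n)) (trans (sum-cong-≗ spoke+inner≡1) (∑-const-1 n)))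
  where
  open EdgeCounts n k (Bijection.to (reference {n}))
  open Counting (Bijection.to (reference {n}))
  outer≡0 : ∀ i → outer i ≡ 0
  outer≡0 i = cut-≡ (trans (parity-interleaving false i) (sym (parity-interleaving false (i ⊕ 1))))
  spoke+inner≡1 : ∀ i → spoke i + inner i ≡ 1
  spoke+inner≡1 i = cong₂ _+_
    (cut-≢ λ eq → 1+n≢0 (trans (sym (parity-interleaving false i)) (trans eq (parity-interleaving true i))))
    (cut-≡ (trans (parity-interleaving true i) (sym (parity-interleaving true (i ⊕ k)))))

module MinimalLabeling (n k : ℕ) .{{_ : NonZero n}} where

  encode : Labeling n → Vec (Fin (2 * n)) (2 * n)
  encode f = Vec.tabulate (Bijection.to f ∘ Inverse.from interleaving)

  decode-with : (σ : Vec (Fin (2 * n)) (2 * n)) → Dec (Bijective _≡_ _≡_ (lookup σ)) → Labeling n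
  decode-with σ (yes bij) = mk⤖ bij ⤖-∘ reference
  decode-with σ (no  _)   = reference

  decode : Vec (Fin (2 * n)) (2 * n) → Labeling n
  decode σ = decode-with σ (bijective? (lookup σ))

  lookup-encode : ∀ f x → lookup (encode f) (Inverse.to interleaving x) ≡ Bijection.to f x
  lookup-encode f x =
    trans (lookup∘tabulate _ (Inverse.to interleaving x)) (cong (Bijection.to f) (Inverse.strictlyInverseʳ interleaving x))

  encode-bijective : ∀ f → Bijective _≡_ _≡_ (lookup (encode f))
  encode-bijective f = injective , strictlySurjective⇒surjective surjective
    where
    open Inverse (interleaving {n}) using (to; from; strictlyInverseˡ)
    lookup-encode′ : ∀ a → lookup (encode f) a ≡ Bijection.to f (from a)
    lookup-encode′ = lookup∘tabulate _
    injective : ∀ {a b} → lookup (encode f) a ≡ lookup (encode f) b → a ≡ b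
    injective {a} {b} eq = begin
      a             ≡⟨ strictlyInverseˡ a ⟨
      to (from a)   ≡⟨ cong to (Bijection.injective f (trans (sym (lookup-encode′ a)) (trans eq (lookup-encode′ b)))) ⟩
      to (from b)   ≡⟨ strictlyInverseˡ b ⟩
      b             ∎
      where open ≡-Reasoning
    surjective : ∀ y → ∃ λ a → lookup (encode f) a ≡ y
    surjective y with x , fx≡y ← Bijection.strictlySurjective f y = to x , trans (lookup-encode f x) fx≡y

  rnaCount-decode-encode : ∀ f d → rnaCount n k (decode-with (encode f) d) ≡ rnaCount n k f
  rnaCount-decode-encode f (yes _)  = diffParityEdges-cong (lookup-encode f) (PEdges n k)
  rnaCount-decode-encode f (no ¬bij) = contradiction (encode-bijective f) ¬bij

  rnaCount-attainsMinimum : ∃ λ f → ∀ g → rnaCount n k f ≤ rnaCount n k g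
  rnaCount-attainsMinimum = attainsMinimum-via-section (rnaCount n k) decode encode
    (λ f → rnaCount-decode-encode f (bijective? (lookup (encode f))))
    (Vec-attainsMinima (Fin-attainsMinima {{m*n≢0 2 n}}) (2 * n))

theorem4p2 : (n k : ℕ) → 3 ≤ n → 1 ≤ k → 2 * k < n → ∀ .{{_ : NonZero n}} →
    Σ ℕ (λ m → IsRnaNumber n k m × (3 ≤ m × m ≤ n))
theorem4p2 n k 3≤n 1≤k 2k<n =
  rnaCount n k f , ((f , refl) , minimal) ,
  EdgeCounts.three≤count n k (Bijection.to f) 3≤n 1≤k 2k<n (Bijection.strictlySurjective f) ,
  ≤-trans (minimal reference) (≤-reflexive (rnaCount-reference n k))
  where
  f : Labeling n
  f = proj₁ (MinimalLabeling.rnaCount-attainsMinimum n k)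
  minimal : ∀ g → rnaCount n k f ≤ rnaCount n k g
  minimal = proj₂ (MinimalLabeling.rnaCount-attainsMinimum n k)
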